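{- The following problem is decidable: given a semilinear equivariant nondeterministic finite automaton with the integer atoms, decide whether the language it accepts is empty.
   Context: Integer atoms: the atoms are the integers $\mathbb{Z}$ with the successor function; the automorphisms are exactly the translations $x\mapsto x+z$, acting hereditarily on sets built from atoms. A set, relation or function is equivariant if invariant under all translations; an equivariant set is orbit-finite if it is a finite union of orbits. For $k\ge1$, $\mathbb{Z}_k$ is the integers modulo $k$ with translations acting by addition, $\mathbb{Z}_0=\mathbb{Z}$; every equivariant single-orbit set is equivariantly isomorphic to some $\mathbb{Z}_k$. A monomial set is a finite product of equivariant single-orbit sets, a polynomial set a finite disjoint union of monomials. A subset of $\mathbb{Z}^m$ is semilinear if Presburger-definable; every subset of $\mathbb{Z}_k$ ($k\ge1$) is semilinear; subsets of general monomials and polynomial sets are semilinear if they are semilinear after transport along equivariant isomorphisms to disjoint unions of monomials $\mathbb{Z}^m$, $\mathbb{Z}_k$ (via $\mathbb{Z}_k\times\mathbb{Z}\cong k$ copies of $\mathbb{Z}$, $\mathbb{Z}_k\times\mathbb{Z}_l\cong\mathbb{Z}_{\mathrm{lcm}(k,l)}$), componentwise. An NFA with atoms consists of an orbit-finite equivariant alphabet $A$, an orbit-finite equivariant state set $Q$, a transition relation $\delta\subseteq Q\times A\times Q$, and initial and accepting sets $I,F\subseteq Q$. It is equivariant if $\delta,I,F$ are equivariant, and semilinear if $\delta$ is a semilinear subset of the polynomial set $Q\times A\times Q$. The input is given by the characteristics of the orbits and Presburger descriptions of $\delta$ on each monomial. -}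

module Defs where

open import Data.Nat using (ℕ; suc)
open import Data.Integer using (ℤ; +_; _+_; _*_; _-_; _≤_)
open import Data.Integer.Divisibility using (_∣_)
open import Data.Fin using (Fin; zero; suc)
open import Data.Bool using (Bool; true)
open import Data.List using (List; []; _∷_)
open import Data.Product using (Σ; ∃; _×_; _,_; proj₁)
open import Data.Sum using (_⊎_)
open import Relation.Nullary using (¬_)
open import Relation.Binary.PropositionalEquality using (_≡_)

-- Presburger arithmetic over ℤ (de Bruijn variables, n free variables)

data Term (n : ℕ) : Set where
  var   : Fin n → Term n
  const : ℤ → Term n
  _⊕_   : Term n → Term n → Term n
  scale : ℤ → Term n → Term n

data Formula (n : ℕ) : Set where
  _≤ᶠ_ : Term n → Term n → Formula n
  _≐_  : Term n → Term n → Formula n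
  ¬ᶠ_  : Formula n → Formula n
  _∧ᶠ_ : Formula n → Formula n → Formula n
  _∨ᶠ_ : Formula n → Formula n → Formula n
  ∃ᶠ   : Formula (suc n) → Formula n
  ∀ᶠ   : Formula (suc n) → Formula n

Env : ℕ → Set
Env n = Fin n → ℤ

extend : ∀ {n} → ℤ → Env n → Env (suc n)
extend x ρ zero    = x
extend x ρ (suc i) = ρ i

⟦_⟧ₜ : ∀ {n} → Term n → Env n → ℤ
⟦ var i ⟧ₜ ρ     = ρ i
⟦ const c ⟧ₜ ρ   = c
⟦ s ⊕ t ⟧ₜ ρ     = ⟦ s ⟧ₜ ρ + ⟦ t ⟧ₜ ρ
⟦ scale c t ⟧ₜ ρ = c * ⟦ t ⟧ₜ ρ

⟦_⟧ : ∀ {n} → Formula n → Env n → Set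
⟦ s ≤ᶠ t ⟧ ρ = ⟦ s ⟧ₜ ρ ≤ ⟦ t ⟧ₜ ρ
⟦ s ≐ t ⟧ ρ  = ⟦ s ⟧ₜ ρ ≡ ⟦ t ⟧ₜ ρ
⟦ ¬ᶠ φ ⟧ ρ   = ¬ ⟦ φ ⟧ ρ
⟦ φ ∧ᶠ ψ ⟧ ρ = ⟦ φ ⟧ ρ × ⟦ ψ ⟧ ρ
⟦ φ ∨ᶠ ψ ⟧ ρ = ⟦ φ ⟧ ρ ⊎ ⟦ ψ ⟧ ρ
⟦ ∃ᶠ φ ⟧ ρ   = Σ ℤ λ x → ⟦ φ ⟧ (extend x ρ)
⟦ ∀ᶠ φ ⟧ ρ   = (x : ℤ) → ⟦ φ ⟧ (extend x ρ)

env3 : ℤ → ℤ → ℤ → Env 3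
env3 x y z zero             = x
env3 x y z (suc zero)       = y
env3 x y z (suc (suc zero)) = z

-- ℤ_k (k = 0 means ℤ): elements represented by integers, equal iff
-- congruent modulo k (for k = 0: equal).

_≡[_]_ : ℤ → ℕ → ℤ → Set
x ≡[ k ] y = (+ k) ∣ (x - y)

-- An orbit-finite equivariant set given by the characteristics of its
-- orbits: orbit i is ℤ_(ch i).  Elements: (orbit index, representative).
Elem : ∀ {n} → (Fin n → ℕ) → Set
Elem {n} ch = Fin n × ℤ

shift : ∀ {n} {ch : Fin n → ℕ} → ℤ → Elem ch → Elem ch
shift t (i , x) = (i , x + t)

-- Semilinear NFA with integer atoms, in the input format:
-- alphabet A = ⊔_i ℤ_(alph i), states Q = ⊔_j ℤ_(stat j),
-- δ restricted to the monomial ℤ_(stat p) × ℤ_(alph a) × ℤ_(stat q) is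
-- the image of the Presburger-definable set ⟦ δ p a q ⟧ ⊆ ℤ³ under the
-- quotient map ℤ³ → ℤ_(stat p) × ℤ_(alph a) × ℤ_(stat q).
-- I and F are subsets of Q; equivariant subsets of Q are unions of orbits,
-- so they are given by a Boolean per orbit.

record SNFA : Set where
  field
    nA nQ : ℕ
    alph  : Fin nA → ℕ
    stat  : Fin nQ → ℕ
    δ     : Fin nQ → Fin nA → Fin nQ → Formula 3
    init  : Fin nQ → Bool
    final : Fin nQ → Bool

module _ (N : SNFA) where
  open SNFA N

  Letter : Set
  Letter = Elem alph

  State : Set
  State = Elem stat

  Trans : State → Letter → State → Set
  Trans (p , x) (a , y) (q , z) =
    ∃ λ x' → ∃ λ y' → ∃ λ z' →
      (x ≡[ stat p ] x') × (y ≡[ alph a ] y') × (z ≡[ stat q ] z') ×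
      ⟦ δ p a q ⟧ (env3 x' y' z')

  Initial : State → Set
  Initial (p , _) = init p ≡ true

  Final : State → Set
  Final (p , _) = final p ≡ true

  Equivariant : Set
  Equivariant = ∀ (t : ℤ) (s : State) (a : Letter) (s' : State) →
    Trans s a s' → Trans (shift {ch = stat} t s) (shift {ch = alph} t a) (shift {ch = stat} t s')

  data Run : State → List Letter → State → Set where
    done : ∀ {s} → Run s [] s
    step : ∀ {s a s' w s''} → Trans s a s' → Run s' w s'' → Run s (a ∷ w) s''

  Accepts : List Letter → Set
  Accepts w = ∃ λ s → ∃ λ s' → Initial s × Run s w s' × Final s'

  LanguageEmpty : Set
  LanguageEmpty = (w : List Letter) → ¬ Accepts w

module Submission where

-- Since δ is invariant under translations, a transition from orbit p to orbit q
-- can be moved to start at any state of orbit p.  Hence the language is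
-- nonempty iff, in the finite orbit graph (an edge p → q when some Presburger
-- set ⟦ δ p a q ⟧ ⊆ ℤ³ is nonempty), an initial orbit reaches a final one.
-- Edges are decidable because Presburger arithmetic is decidable, and
-- reachability in a finite graph is decidable by bounding the length of walks.

open import Defs
open import Relation.Nullary using (Dec; yes; no; ¬_)
open import Relation.Nullary.Decidable as Dec using (_×-dec_; _⊎-dec_; ¬?; decidable-stable)
open import Data.Empty using (⊥; ⊥-elim)
open import Data.Unit using (⊤; tt)
open import Data.Bool using (true)
import Data.Bool.Properties as BoolP
open import Data.Nat as ℕ using (ℕ; zero; suc; z≤n; s≤s)
import Data.Nat.Properties as ℕP
import Data.Nat.Divisibility as ℕDiv
import Data.Nat.Tactic.RingSolver as ℕSolver
open import Data.Fin as Fin using (Fin; zero; suc)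
import Data.Fin.Properties as FinP
open import Data.Integer as ℤ using (ℤ; +_; -[1+_]; _+_; _*_; _-_; -_; _≤_; _⊓_; +≤+; -≤+; 0ℤ; 1ℤ; -1ℤ)
import Data.Integer.Properties as ℤP
import Data.Integer.DivMod as DM
open import Data.Integer.Divisibility.Signed as Div using (divides) renaming (_∣_ to _∣ₛ_)
open import Data.Integer.Tactic.RingSolver using (solve-∀)
open import Data.List using (List; []; _∷_; _++_; length; lookup; upTo)
open import Data.List.Membership.Propositional using (_∈_)
open import Data.List.Membership.Propositional.Properties using (∈-++⁺ˡ; ∈-++⁺ʳ; ∈-upTo⁺; ∈-upTo⁻; ∈-lookup)
import Data.List.Membership.DecPropositional as DecMembership
open import Data.List.Relation.Unary.Any using (here; there)
import Data.List.Relation.Unary.All as All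
open import Data.List.Relation.Unary.All.Properties.Core using (¬Any⇒All¬)
open import Data.List.Relation.Unary.AllPairs using ([]; _∷_)
open import Data.List.Relation.Unary.Unique.Propositional using (Unique)
open import Data.Product using (Σ; _×_; _,_; proj₁; map₁; map₂; uncurry)
open import Data.Sum using (_⊎_; inj₁; inj₂)
open import Function.Bundles using (_⇔_; mk⇔; Equivalence)
open import Function.Properties.Equivalence using (⇔-isEquivalence; ⇔-setoid)
open import Data.Product.Function.NonDependent.Propositional using (_×-⇔_)
open import Data.Sum.Function.Propositional using (_⊎-⇔_)
open import Relation.Binary.Structures using (IsEquivalence)
import Relation.Binary.Reasoning.Setoid as ⇔-Reasoning
open import Relation.Binary.PropositionalEquality using (_≡_; _≢_; refl; sym; trans; cong; cong₂; subst)
open import Level using (0ℓ)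

open IsEquivalence (⇔-isEquivalence {0ℓ}) using () renaming (refl to ⇔-refl; sym to ⇔-sym; trans to ⇔-trans)
open Equivalence using (to; from)

private variable n : ℕ

≡⇒⇔ : {A B : Set} → A ≡ B → A ⇔ B
≡⇒⇔ refl = ⇔-refl

¬-⇔ : {A B : Set} → A ⇔ B → (¬ A) ⇔ (¬ B)
¬-⇔ A⇔B = mk⇔ (λ ¬a b → ¬a (from A⇔B b)) (λ ¬b a → ¬b (to A⇔B a))

data Lin : ℕ → Set where
  cst : ℤ → Lin zero
  _▹_ : ℤ → Lin n → Lin (suc n)

infixr 5 _▹_

tail : Env (suc n) → Env n
tail ρ i = ρ (suc i)

⟦_⟧ˡ : Lin n → Env n → ℤ
⟦ cst k ⟧ˡ ρ   = k
⟦ c ▹ t ⟧ˡ ρ = c * ρ zero + ⟦ t ⟧ˡ (tail ρ)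

infixl 6 _+ˡ_
infixr 7 _·ˡ_

_+ˡ_ : Lin n → Lin n → Lin n
cst k +ˡ cst l = cst (k + l)
(c ▹ s) +ˡ (d ▹ t) = (c + d) ▹ (s +ˡ t)

_·ˡ_ : ℤ → Lin n → Lin n
a ·ˡ cst k = cst (a * k)
a ·ˡ (c ▹ t) = (a * c) ▹ (a ·ˡ t)

constˡ : ∀ n → ℤ → Lin n
constˡ zero k    = cst k
constˡ (suc n) k = 0ℤ ▹ constˡ n k

varˡ : Fin n → Lin n
varˡ {suc n} zero    = 1ℤ ▹ constˡ n 0ℤ
varˡ {suc n} (suc i) = 0ℤ ▹ varˡ i

⟦+ˡ⟧ : (s t : Lin n) (ρ : Env n) → ⟦ s +ˡ t ⟧ˡ ρ ≡ ⟦ s ⟧ˡ ρ + ⟦ t ⟧ˡ ρ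
⟦+ˡ⟧ (cst k) (cst l) ρ = refl
⟦+ˡ⟧ (c ▹ s) (d ▹ t) ρ = trans (cong (_+_ ((c + d) * ρ zero)) (⟦+ˡ⟧ s t (tail ρ))) (regroup c d (ρ zero) _ _)
  where
  regroup : ∀ c d x u v → (c + d) * x + (u + v) ≡ (c * x + u) + (d * x + v)
  regroup = solve-∀

⟦·ˡ⟧ : (a : ℤ) (t : Lin n) (ρ : Env n) → ⟦ a ·ˡ t ⟧ˡ ρ ≡ a * ⟦ t ⟧ˡ ρ
⟦·ˡ⟧ a (cst k) ρ = refl
⟦·ˡ⟧ a (c ▹ t) ρ = trans (cong (_+_ ((a * c) * ρ zero)) (⟦·ˡ⟧ a t (tail ρ))) (distrib a c (ρ zero) _)
  where
  distrib : ∀ a c x u → (a * c) * x + a * u ≡ a * (c * x + u)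
  distrib = solve-∀

zero-coeff : ∀ x u → 0ℤ * x + u ≡ u
zero-coeff = solve-∀

⟦constˡ⟧ : ∀ n k (ρ : Env n) → ⟦ constˡ n k ⟧ˡ ρ ≡ k
⟦constˡ⟧ zero k ρ    = refl
⟦constˡ⟧ (suc n) k ρ = trans (zero-coeff (ρ zero) _) (⟦constˡ⟧ n k (tail ρ))

⟦varˡ⟧ : (i : Fin n) (ρ : Env n) → ⟦ varˡ i ⟧ˡ ρ ≡ ρ i
⟦varˡ⟧ {suc n} zero ρ    = trans (cong (_+_ (1ℤ * ρ zero)) (⟦constˡ⟧ n 0ℤ (tail ρ))) (unit-coeff (ρ zero))
  where
  unit-coeff : ∀ x → 1ℤ * x + 0ℤ ≡ x
  unit-coeff = solve-∀
⟦varˡ⟧ {suc n} (suc i) ρ = trans (zero-coeff (ρ zero) _) (⟦varˡ⟧ i (tail ρ))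

-- Quantifier-free Presburger formulas in negation normal form.  The atoms are
-- 0 ≤ t and (1+d) ∣ t, ¬ (1+d) ∣ t (moduli are stored by their predecessor).
data QF (n : ℕ) : Set where
  ⊤q ⊥q     : QF n
  nonneg    : Lin n → QF n
  dvd ndvd  : ℕ → Lin n → QF n
  _∧q_ _∨q_ : QF n → QF n → QF n

infixr 3 _∧q_
infixr 2 _∨q_

⟦_⟧q : QF n → Env n → Set
⟦ ⊤q ⟧q ρ       = ⊤
⟦ ⊥q ⟧q ρ       = ⊥
⟦ nonneg t ⟧q ρ = 0ℤ ≤ ⟦ t ⟧ˡ ρ
⟦ dvd d t ⟧q ρ  = + suc d ∣ₛ ⟦ t ⟧ˡ ρ
⟦ ndvd d t ⟧q ρ = ¬ (+ suc d ∣ₛ ⟦ t ⟧ˡ ρ)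
⟦ φ ∧q ψ ⟧q ρ   = ⟦ φ ⟧q ρ × ⟦ ψ ⟧q ρ
⟦ φ ∨q ψ ⟧q ρ   = ⟦ φ ⟧q ρ ⊎ ⟦ ψ ⟧q ρ

⟦_⟧q? : (φ : QF n) (ρ : Env n) → Dec (⟦ φ ⟧q ρ)
⟦ ⊤q ⟧q? ρ       = yes tt
⟦ ⊥q ⟧q? ρ       = no λ ()
⟦ nonneg t ⟧q? ρ = 0ℤ ℤP.≤? ⟦ t ⟧ˡ ρ
⟦ dvd d t ⟧q? ρ  = + suc d Div.∣? ⟦ t ⟧ˡ ρ
⟦ ndvd d t ⟧q? ρ = ¬? (+ suc d Div.∣? ⟦ t ⟧ˡ ρ)
⟦ φ ∧q ψ ⟧q? ρ   = ⟦ φ ⟧q? ρ ×-dec ⟦ ψ ⟧q? ρ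
⟦ φ ∨q ψ ⟧q? ρ   = ⟦ φ ⟧q? ρ ⊎-dec ⟦ ψ ⟧q? ρ

negQ : QF n → QF n
negQ ⊤q         = ⊥q
negQ ⊥q         = ⊤q
negQ {n} (nonneg t) = nonneg ((-1ℤ ·ˡ t) +ˡ constˡ n -1ℤ)
negQ (dvd d t)  = ndvd d t
negQ (ndvd d t) = dvd d t
negQ (φ ∧q ψ)   = negQ φ ∨q negQ ψ
negQ (φ ∨q ψ)   = negQ φ ∧q negQ ψ

0≰-1 : ¬ (0ℤ ≤ -1ℤ)
0≰-1 ()

negative⇔ : ∀ e → (0ℤ ≤ -1ℤ * e + -1ℤ) ⇔ (¬ (0ℤ ≤ e))
negative⇔ e = mk⇔
  (λ p q → 0≰-1 (subst (0ℤ ≤_) (cancel e) (ℤP.+-mono-≤ p q)))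
  (λ ¬p → subst (0ℤ ≤_) (rearrange e) (ℤP.i≤j⇒0≤j-i (ℤP.i<j⇒suc[i]≤j (ℤP.≰⇒> ¬p))))
  where
  cancel : ∀ e → (-1ℤ * e + -1ℤ) + e ≡ -1ℤ
  cancel = solve-∀
  rearrange : ∀ e → 0ℤ - (1ℤ + e) ≡ -1ℤ * e + -1ℤ
  rearrange = solve-∀

negQ-correct : (φ : QF n) (ρ : Env n) → ⟦ negQ φ ⟧q ρ ⇔ (¬ ⟦ φ ⟧q ρ)
negQ-correct ⊤q ρ = mk⇔ (λ ()) (λ ¬⊤ → ¬⊤ tt)
negQ-correct ⊥q ρ = mk⇔ (λ _ ()) (λ _ → tt)
negQ-correct {n} (nonneg t) ρ = ⇔-trans (≡⇒⇔ (cong (0ℤ ≤_) value)) (negative⇔ (⟦ t ⟧ˡ ρ))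
  where
  value : ⟦ (-1ℤ ·ˡ t) +ˡ constˡ n -1ℤ ⟧ˡ ρ ≡ -1ℤ * ⟦ t ⟧ˡ ρ + -1ℤ
  value = trans (⟦+ˡ⟧ (-1ℤ ·ˡ t) _ ρ) (cong₂ _+_ (⟦·ˡ⟧ -1ℤ t ρ) (⟦constˡ⟧ n -1ℤ ρ))
negQ-correct (dvd d t) ρ  = mk⇔ (λ p → p) (λ p → p)
negQ-correct (ndvd d t) ρ = mk⇔ (λ p q → q p) (decidable-stable (+ suc d Div.∣? ⟦ t ⟧ˡ ρ))
negQ-correct (φ ∧q ψ) ρ = mk⇔
  (λ { (inj₁ ¬φ) (p , _) → to (negQ-correct φ ρ) ¬φ p ; (inj₂ ¬ψ) (_ , q) → to (negQ-correct ψ ρ) ¬ψ q })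
  deMorgan
  where
  deMorgan : ¬ (⟦ φ ⟧q ρ × ⟦ ψ ⟧q ρ) → ⟦ negQ φ ⟧q ρ ⊎ ⟦ negQ ψ ⟧q ρ
  deMorgan ¬φψ with ⟦ φ ⟧q? ρ
  ... | no ¬p = inj₁ (from (negQ-correct φ ρ) ¬p)
  ... | yes p = inj₂ (from (negQ-correct ψ ρ) (λ q → ¬φψ (p , q)))
negQ-correct (φ ∨q ψ) ρ = mk⇔
  (λ { (¬φ , ¬ψ) (inj₁ p) → to (negQ-correct φ ρ) ¬φ p ; (¬φ , ¬ψ) (inj₂ q) → to (negQ-correct ψ ρ) ¬ψ q })
  (λ ¬φψ → from (negQ-correct φ ρ) (λ p → ¬φψ (inj₁ p)) , from (negQ-correct ψ ρ) (λ q → ¬φψ (inj₂ q)))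

-- Formulas about a distinguished integer y and parameters ρ in which y occurs
-- with coefficient ±1 only ("unit form", the input of Cooper's method).
data UF (n : ℕ) : Set where
  free        : QF n → UF n
  lower upper : Lin n → UF n
  dvdʸ ndvdʸ  : ℕ → Lin n → UF n
  _∧u_ _∨u_   : UF n → UF n → UF n

infixr 3 _∧u_
infixr 2 _∨u_

⟦_⟧ᵘ : UF n → ℤ → Env n → Set
⟦ free φ ⟧ᵘ y ρ    = ⟦ φ ⟧q ρ
⟦ lower t ⟧ᵘ y ρ   = 0ℤ ≤ y + ⟦ t ⟧ˡ ρ
⟦ upper t ⟧ᵘ y ρ   = 0ℤ ≤ - y + ⟦ t ⟧ˡ ρ
⟦ dvdʸ d t ⟧ᵘ y ρ  = + suc d ∣ₛ y + ⟦ t ⟧ˡ ρ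
⟦ ndvdʸ d t ⟧ᵘ y ρ = ¬ (+ suc d ∣ₛ y + ⟦ t ⟧ˡ ρ)
⟦ ψ ∧u χ ⟧ᵘ y ρ    = ⟦ ψ ⟧ᵘ y ρ × ⟦ χ ⟧ᵘ y ρ
⟦ ψ ∨u χ ⟧ᵘ y ρ    = ⟦ ψ ⟧ᵘ y ρ ⊎ ⟦ χ ⟧ᵘ y ρ

-- Positive integers are represented by their predecessor; a ⊛ b represents
-- the product, i.e. suc (a ⊛ b) reduces to suc a * suc b.
_⊛_ : ℕ → ℕ → ℕ
a ⊛ b = b ℕ.+ a ℕ.* suc b

-- The factor |c| contributed by a coefficient c (1 if c = 0), by its predecessor.
factor : ℤ → ℕ
factor (+ zero)  = 0
factor (+ suc k) = k
factor -[1+ k ]  = k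

coeffProduct : QF (suc n) → ℕ
coeffProduct (nonneg (c ▹ t)) = factor c
coeffProduct (dvd d (c ▹ t))  = factor c
coeffProduct (ndvd d (c ▹ t)) = factor c
coeffProduct (φ ∧q ψ)         = coeffProduct φ ⊛ coeffProduct ψ
coeffProduct (φ ∨q ψ)         = coeffProduct φ ⊛ coeffProduct ψ
coeffProduct _                = 0

-- scaleTo m φ multiplies every atom of φ by a positive factor so that each
-- coefficient of x₀ becomes ±L, L = (1+m)·(1+coeffProduct φ), and reads the
-- result as a unit-form formula in y = L·x₀.
scaleTo : ℕ → QF (suc n) → UF n
scaleTo m ⊤q                          = free ⊤q
scaleTo m ⊥q                          = free ⊥q
scaleTo m (nonneg (+ zero ▹ t))       = free (nonneg t)
scaleTo m (nonneg (+ suc k ▹ t))      = lower (+ suc m ·ˡ t)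
scaleTo m (nonneg (-[1+ k ] ▹ t))     = upper (+ suc m ·ˡ t)
scaleTo m (dvd d (+ zero ▹ t))        = free (dvd d t)
scaleTo m (dvd d (+ suc k ▹ t))       = dvdʸ (m ⊛ d) (+ suc m ·ˡ t)
scaleTo m (dvd d (-[1+ k ] ▹ t))      = dvdʸ (m ⊛ d) ((- + suc m) ·ˡ t)
scaleTo m (ndvd d (+ zero ▹ t))       = free (ndvd d t)
scaleTo m (ndvd d (+ suc k ▹ t))      = ndvdʸ (m ⊛ d) (+ suc m ·ˡ t)
scaleTo m (ndvd d (-[1+ k ] ▹ t))     = ndvdʸ (m ⊛ d) ((- + suc m) ·ˡ t)
scaleTo m (φ ∧q ψ) = scaleTo (m ⊛ coeffProduct ψ) φ ∧u scaleTo (m ⊛ coeffProduct φ) ψ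
scaleTo m (φ ∨q ψ) = scaleTo (m ⊛ coeffProduct ψ) φ ∨u scaleTo (m ⊛ coeffProduct φ) ψ

0≤-scale : ∀ m z → (0ℤ ≤ + suc m * z) ⇔ (0ℤ ≤ z)
0≤-scale m z = mk⇔
  (λ p → ℤP.*-cancelˡ-≤-pos 0ℤ z (+ suc m) (subst (_≤ + suc m * z) (sym (ℤP.*-zeroʳ (+ suc m))) p))
  (λ p → subst (_≤ + suc m * z) (ℤP.*-zeroʳ (+ suc m)) (ℤP.*-monoˡ-≤-nonNeg (+ suc m) p))

∣-scale : ∀ m d z → (+ suc (m ⊛ d) ∣ₛ + suc m * z) ⇔ (+ suc d ∣ₛ z)
∣-scale m d z = mk⇔
  (λ p → Div.*-cancelˡ-∣ (+ suc m) (subst (_∣ₛ + suc m * z) (ℤP.pos-* (suc m) (suc d)) p))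
  (λ p → subst (_∣ₛ + suc m * z) (sym (ℤP.pos-* (suc m) (suc d))) (Div.*-monoʳ-∣ (+ suc m) p))

∣-neg : ∀ {a} z → (a ∣ₛ - z) ⇔ (a ∣ₛ z)
∣-neg z = mk⇔ (λ p → subst (_ ∣ₛ_) (ℤP.neg-involutive z) (Div.∣m⇒∣-m p)) Div.∣m⇒∣-m

module ScaledAtoms (m k : ℕ) (x e : ℤ) where
  s : ℤ
  s = + suc m

  y : ℤ
  y = + (suc m ℕ.* suc k) * x

  y≡ : y ≡ s * + suc k * x
  y≡ = cong (_* x) (ℤP.pos-* (suc m) (suc k))

  positive : y + s * e ≡ s * (+ suc k * x + e)
  positive = trans (cong (_+ s * e) y≡) (law s (+ suc k) x e)
    where
    law : ∀ s c x e → s * c * x + s * e ≡ s * (c * x + e)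
    law = solve-∀

  negative : - y + s * e ≡ s * (- + suc k * x + e)
  negative = trans (cong (λ u → - u + s * e) y≡) (law s (+ suc k) x e)
    where
    law : ∀ s c x e → - (s * c * x) + s * e ≡ s * (- c * x + e)
    law = solve-∀

  negated : y + - s * e ≡ - (s * (- + suc k * x + e))
  negated = trans (cong (_+ - s * e) y≡) (law s (+ suc k) x e)
    where
    law : ∀ s c x e → s * c * x + - s * e ≡ - (s * (- c * x + e))
    law = solve-∀

-- The scaling factor handed to each side of ∧ and ∨ makes it reach the same L.
sideˡ : ∀ m a b {L} → suc m ℕ.* suc (a ⊛ b) ≡ L → suc (m ⊛ b) ℕ.* suc a ≡ L
sideˡ m a b = trans (law m a b)
  where
  law : ∀ m a b → suc m ℕ.* suc b ℕ.* suc a ≡ suc m ℕ.* (suc a ℕ.* suc b)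
  law = ℕSolver.solve-∀

sideʳ : ∀ m a b {L} → suc m ℕ.* suc (a ⊛ b) ≡ L → suc (m ⊛ a) ℕ.* suc b ≡ L
sideʳ m a b = trans (law m a b)
  where
  law : ∀ m a b → suc m ℕ.* suc a ℕ.* suc b ≡ suc m ℕ.* (suc a ℕ.* suc b)
  law = ℕSolver.solve-∀

scaleTo-correct : ∀ m (φ : QF (suc n)) L → suc m ℕ.* suc (coeffProduct φ) ≡ L → ∀ x ρ →
                  ⟦ scaleTo m φ ⟧ᵘ (+ L * x) ρ ⇔ ⟦ φ ⟧q (extend x ρ)
scaleTo-correct m ⊤q L eq x ρ = ⇔-refl
scaleTo-correct m ⊥q L eq x ρ = ⇔-refl
scaleTo-correct m (nonneg (+ zero ▹ t)) L eq x ρ = ≡⇒⇔ (cong (0ℤ ≤_) (sym (zero-coeff x _)))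
scaleTo-correct m (nonneg (+ suc k ▹ t)) L refl x ρ = ⇔-trans
  (≡⇒⇔ (cong (0ℤ ≤_) (trans (cong (_+_ y) (⟦·ˡ⟧ (+ suc m) t ρ)) positive))) (0≤-scale m _)
  where open ScaledAtoms m k x (⟦ t ⟧ˡ ρ)
scaleTo-correct m (nonneg (-[1+ k ] ▹ t)) L refl x ρ = ⇔-trans
  (≡⇒⇔ (cong (0ℤ ≤_) (trans (cong (_+_ (- y)) (⟦·ˡ⟧ (+ suc m) t ρ)) negative))) (0≤-scale m _)
  where open ScaledAtoms m k x (⟦ t ⟧ˡ ρ)
scaleTo-correct m (dvd d (+ zero ▹ t)) L eq x ρ = ≡⇒⇔ (cong (_ ∣ₛ_) (sym (zero-coeff x _)))
scaleTo-correct m (dvd d (+ suc k ▹ t)) L refl x ρ = ⇔-trans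
  (≡⇒⇔ (cong (_ ∣ₛ_) (trans (cong (_+_ y) (⟦·ˡ⟧ (+ suc m) t ρ)) positive))) (∣-scale m d _)
  where open ScaledAtoms m k x (⟦ t ⟧ˡ ρ)
scaleTo-correct m (dvd d (-[1+ k ] ▹ t)) L refl x ρ = ⇔-trans
  (≡⇒⇔ (cong (_ ∣ₛ_) (trans (cong (_+_ y) (⟦·ˡ⟧ (- + suc m) t ρ)) negated)))
  (⇔-trans (∣-neg _) (∣-scale m d _))
  where open ScaledAtoms m k x (⟦ t ⟧ˡ ρ)
scaleTo-correct m (ndvd d (+ zero ▹ t)) L eq x ρ = ≡⇒⇔ (cong (λ u → ¬ (_ ∣ₛ u)) (sym (zero-coeff x _)))
scaleTo-correct m (ndvd d (+ suc k ▹ t)) L refl x ρ = ¬-⇔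
  (⇔-trans (≡⇒⇔ (cong (_ ∣ₛ_) (trans (cong (_+_ y) (⟦·ˡ⟧ (+ suc m) t ρ)) positive))) (∣-scale m d _))
  where open ScaledAtoms m k x (⟦ t ⟧ˡ ρ)
scaleTo-correct m (ndvd d (-[1+ k ] ▹ t)) L refl x ρ = ¬-⇔
  (⇔-trans (≡⇒⇔ (cong (_ ∣ₛ_) (trans (cong (_+_ y) (⟦·ˡ⟧ (- + suc m) t ρ)) negated)))
           (⇔-trans (∣-neg _) (∣-scale m d _)))
  where open ScaledAtoms m k x (⟦ t ⟧ˡ ρ)
scaleTo-correct m (φ ∧q ψ) L eq x ρ =
  scaleTo-correct _ φ L (sideˡ m (coeffProduct φ) (coeffProduct ψ) eq) x ρ ×-⇔
  scaleTo-correct _ ψ L (sideʳ m (coeffProduct φ) (coeffProduct ψ) eq) x ρ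
scaleTo-correct m (φ ∨q ψ) L eq x ρ =
  scaleTo-correct _ φ L (sideˡ m (coeffProduct φ) (coeffProduct ψ) eq) x ρ ⊎-⇔
  scaleTo-correct _ ψ L (sideʳ m (coeffProduct φ) (coeffProduct ψ) eq) x ρ

unitForm : QF (suc n) → UF n
unitForm {n} φ = dvdʸ (coeffProduct φ) (constˡ n 0ℤ) ∧u scaleTo 0 φ

unitForm-correct : (φ : QF (suc n)) (ρ : Env n) →
                   (Σ ℤ λ x → ⟦ φ ⟧q (extend x ρ)) ⇔ (Σ ℤ λ y → ⟦ unitForm φ ⟧ᵘ y ρ)
unitForm-correct {n} φ ρ = mk⇔ forth back
  where
  L : ℕ
  L = suc (coeffProduct φ)

  scaled : ∀ x → ⟦ scaleTo 0 φ ⟧ᵘ (+ L * x) ρ ⇔ ⟦ φ ⟧q (extend x ρ)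
  scaled x = scaleTo-correct 0 φ L (ℕP.*-identityˡ L) x ρ

  offset : ∀ y → y + ⟦ constˡ n 0ℤ ⟧ˡ ρ ≡ y
  offset y = trans (cong (_+_ y) (⟦constˡ⟧ n 0ℤ ρ)) (ℤP.+-identityʳ y)

  forth : Σ ℤ (λ x → ⟦ φ ⟧q (extend x ρ)) → Σ ℤ (λ y → ⟦ unitForm φ ⟧ᵘ y ρ)
  forth (x , h) = + L * x
                , subst (+ L ∣ₛ_) (sym (offset _)) (Div.∣m⇒∣m*n x Div.∣-refl)
                , from (scaled x) h

  back : Σ ℤ (λ y → ⟦ unitForm φ ⟧ᵘ y ρ) → Σ ℤ (λ x → ⟦ φ ⟧q (extend x ρ))
  back (y , divides q y≡qL , h) =
    q , to (scaled q) (subst (λ v → ⟦ scaleTo 0 φ ⟧ᵘ v ρ) (trans (sym (offset y)) (trans y≡qL (ℤP.*-comm q (+ L)))) h)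

⋁ : {A : Set} → List A → (A → QF n) → QF n
⋁ []       f = ⊥q
⋁ (a ∷ as) f = f a ∨q ⋁ as f

⋁-correct : {A : Set} (ρ : Env n) (as : List A) (f : A → QF n) {P : A → Set} →
            (∀ a → ⟦ f a ⟧q ρ ⇔ P a) → ⟦ ⋁ as f ⟧q ρ ⇔ (Σ A λ a → a ∈ as × P a)
⋁-correct ρ []       f meaning = mk⇔ (λ ()) (λ { (_ , () , _) })
⋁-correct ρ (a ∷ as) f {P} meaning = mk⇔ forth back
  where
  forth : ⟦ f a ⟧q ρ ⊎ ⟦ ⋁ as f ⟧q ρ → Σ _ λ b → b ∈ a ∷ as × P b
  forth (inj₁ p) = a , here refl , to (meaning a) p
  forth (inj₂ q) with b , b∈as , r ← to (⋁-correct ρ as f meaning) q = b , there b∈as , r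
  back : (Σ _ λ b → b ∈ a ∷ as × P b) → ⟦ f a ⟧q ρ ⊎ ⟦ ⋁ as f ⟧q ρ
  back (b , here refl , r)   = inj₁ (from (meaning b) r)
  back (b , there b∈as , r) = inj₂ (from (⋁-correct ρ as f meaning) (b , b∈as , r))

⋁-upTo : (ρ : Env n) (k : ℕ) (f : ℕ → QF n) {P : ℕ → Set} →
         (∀ j → ⟦ f j ⟧q ρ ⇔ P j) → ⟦ ⋁ (upTo k) f ⟧q ρ ⇔ (Σ ℕ λ j → j ℕ.< k × P j)
⋁-upTo ρ k f meaning = ⇔-trans (⋁-correct ρ (upTo k) f meaning) (mk⇔ (map₂ (map₁ ∈-upTo⁻)) (map₂ (map₁ ∈-upTo⁺)))

infix 5 _[_]ᵘ

_[_]ᵘ : UF n → Lin n → QF n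
free φ [ s ]ᵘ    = φ
lower t [ s ]ᵘ   = nonneg (s +ˡ t)
upper t [ s ]ᵘ   = nonneg (-1ℤ ·ˡ s +ˡ t)
dvdʸ d t [ s ]ᵘ  = dvd d (s +ˡ t)
ndvdʸ d t [ s ]ᵘ = ndvd d (s +ˡ t)
(ψ ∧u χ) [ s ]ᵘ  = ψ [ s ]ᵘ ∧q χ [ s ]ᵘ
(ψ ∨u χ) [ s ]ᵘ  = ψ [ s ]ᵘ ∨q χ [ s ]ᵘ

substitution : (ψ : UF n) (s : Lin n) (ρ : Env n) → ⟦ ψ [ s ]ᵘ ⟧q ρ ⇔ ⟦ ψ ⟧ᵘ (⟦ s ⟧ˡ ρ) ρ
substitution (free φ) s ρ    = ⇔-refl
substitution (lower t) s ρ   = ≡⇒⇔ (cong (0ℤ ≤_) (⟦+ˡ⟧ s t ρ))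
substitution (upper t) s ρ   = ≡⇒⇔ (cong (0ℤ ≤_) (trans (⟦+ˡ⟧ (-1ℤ ·ˡ s) t ρ)
                                 (cong (_+ ⟦ t ⟧ˡ ρ) (trans (⟦·ˡ⟧ -1ℤ s ρ) (ℤP.-1*i≡-i _)))))
substitution (dvdʸ d t) s ρ  = ≡⇒⇔ (cong (_ ∣ₛ_) (⟦+ˡ⟧ s t ρ))
substitution (ndvdʸ d t) s ρ = ¬-⇔ (≡⇒⇔ (cong (_ ∣ₛ_) (⟦+ˡ⟧ s t ρ)))
substitution (ψ ∧u χ) s ρ    = substitution ψ s ρ ×-⇔ substitution χ s ρ
substitution (ψ ∨u χ) s ρ    = substitution ψ s ρ ⊎-⇔ substitution χ s ρ

substitute-const : (ψ : UF n) (j : ℕ) (ρ : Env n) → ⟦ ψ [ constˡ n (+ j) ]ᵘ ⟧q ρ ⇔ ⟦ ψ ⟧ᵘ (+ j) ρ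
substitute-const {n} ψ j ρ = ⇔-trans (substitution ψ _ ρ) (≡⇒⇔ (cong (λ v → ⟦ ψ ⟧ᵘ v ρ) (⟦constˡ⟧ n (+ j) ρ)))

substitute-shifted : (ψ : UF n) (b : Lin n) (j : ℕ) (ρ : Env n) →
                     ⟦ ψ [ b +ˡ constˡ n (+ j) ]ᵘ ⟧q ρ ⇔ ⟦ ψ ⟧ᵘ (⟦ b ⟧ˡ ρ + + j) ρ
substitute-shifted {n} ψ b j ρ = ⇔-trans (substitution ψ _ ρ) (≡⇒⇔ (cong (λ v → ⟦ ψ ⟧ᵘ v ρ) value))
  where
  value : ⟦ b +ˡ constˡ n (+ j) ⟧ˡ ρ ≡ ⟦ b ⟧ˡ ρ + + j
  value = trans (⟦+ˡ⟧ b _ ρ) (cong (_+_ (⟦ b ⟧ˡ ρ)) (⟦constˡ⟧ n (+ j) ρ))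

-- The "left infinite projection" ψ₋∞: the formula ψ(y) for y → -∞, where
-- every lower bound fails and every upper bound holds.
minusInfinity : UF n → UF n
minusInfinity (lower t) = free ⊥q
minusInfinity (upper t) = free ⊤q
minusInfinity (ψ ∧u χ)  = minusInfinity ψ ∧u minusInfinity χ
minusInfinity (ψ ∨u χ)  = minusInfinity ψ ∨u minusInfinity χ
minusInfinity ψ         = ψ

Eventually₋∞ : (ℤ → Set) → Set
Eventually₋∞ P = Σ ℤ λ M → ∀ y → y ≤ M → P y

eventually-both : {P Q : ℤ → Set} → Eventually₋∞ P → Eventually₋∞ Q → Eventually₋∞ (λ y → P y × Q y)
eventually-both (M , p) (N , q) =
  M ⊓ N , λ y y≤M⊓N → p y (ℤP.i≤j⊓k⇒i≤j M N y≤M⊓N) , q y (ℤP.i≤j⊓k⇒i≤k M N y≤M⊓N)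

minusInfinity-agrees : (ψ : UF n) (ρ : Env n) → Eventually₋∞ λ y → ⟦ minusInfinity ψ ⟧ᵘ y ρ ⇔ ⟦ ψ ⟧ᵘ y ρ
minusInfinity-agrees (lower t) ρ = -1ℤ - ⟦ t ⟧ˡ ρ , λ y y≤M →
  mk⇔ (λ ()) (λ 0≤y+t → 0≰-1 (ℤP.≤-trans 0≤y+t
    (subst (y + ⟦ t ⟧ˡ ρ ≤_) (cancel (⟦ t ⟧ˡ ρ)) (ℤP.+-monoˡ-≤ (⟦ t ⟧ˡ ρ) y≤M))))
  where
  cancel : ∀ e → (-1ℤ - e) + e ≡ -1ℤ
  cancel = solve-∀
minusInfinity-agrees (upper t) ρ = ⟦ t ⟧ˡ ρ , λ y y≤M →
  mk⇔ (λ _ → subst (0ℤ ≤_) (ℤP.+-comm (⟦ t ⟧ˡ ρ) (- y)) (ℤP.i≤j⇒0≤j-i y≤M)) (λ _ → tt)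
minusInfinity-agrees (ψ ∧u χ) ρ = map₂ (λ agree y y≤M → uncurry _×-⇔_ (agree y y≤M))
  (eventually-both (minusInfinity-agrees ψ ρ) (minusInfinity-agrees χ ρ))
minusInfinity-agrees (ψ ∨u χ) ρ = map₂ (λ agree y y≤M → uncurry _⊎-⇔_ (agree y y≤M))
  (eventually-both (minusInfinity-agrees ψ ρ) (minusInfinity-agrees χ ρ))
minusInfinity-agrees (free φ) ρ    = 0ℤ , λ _ _ → ⇔-refl
minusInfinity-agrees (dvdʸ d t) ρ  = 0ℤ , λ _ _ → ⇔-refl
minusInfinity-agrees (ndvdʸ d t) ρ = 0ℤ , λ _ _ → ⇔-refl

-- Predecessor of the product of the moduli of the y-atoms of ψ; its successor
-- δ is a common period of all of them.
period : UF n → ℕ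
period (dvdʸ d t)  = d
period (ndvdʸ d t) = d
period (ψ ∧u χ)    = period ψ ⊛ period χ
period (ψ ∨u χ)    = period ψ ⊛ period χ
period _           = 0

ModuliDivide : ℤ → UF n → Set
ModuliDivide D (dvdʸ d t)  = + suc d ∣ₛ D
ModuliDivide D (ndvdʸ d t) = + suc d ∣ₛ D
ModuliDivide D (ψ ∧u χ)    = ModuliDivide D ψ × ModuliDivide D χ
ModuliDivide D (ψ ∨u χ)    = ModuliDivide D ψ × ModuliDivide D χ
ModuliDivide D _           = ⊤

moduliDivide-∣ : ∀ {D E} → D ∣ₛ E → (ψ : UF n) → ModuliDivide D ψ → ModuliDivide E ψ
moduliDivide-∣ D∣E (dvdʸ d t) d∣D         = Div.∣-trans d∣D D∣E
moduliDivide-∣ D∣E (ndvdʸ d t) d∣D        = Div.∣-trans d∣D D∣E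
moduliDivide-∣ D∣E (ψ ∧u χ) (mψ , mχ)     = moduliDivide-∣ D∣E ψ mψ , moduliDivide-∣ D∣E χ mχ
moduliDivide-∣ D∣E (ψ ∨u χ) (mψ , mχ)     = moduliDivide-∣ D∣E ψ mψ , moduliDivide-∣ D∣E χ mχ
moduliDivide-∣ D∣E (free φ) tt            = tt
moduliDivide-∣ D∣E (lower t) tt           = tt
moduliDivide-∣ D∣E (upper t) tt           = tt

moduliDivide-period : (ψ : UF n) → ModuliDivide (+ suc (period ψ)) ψ

productDivides : (ψ χ : UF n) → ModuliDivide (+ suc (period ψ ⊛ period χ)) ψ × ModuliDivide (+ suc (period ψ ⊛ period χ)) χ
productDivides ψ χ =
  moduliDivide-∣ (product (Div.∣m⇒∣m*n (+ suc (period χ)) Div.∣-refl)) ψ (moduliDivide-period ψ) ,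
  moduliDivide-∣ (product (Div.∣n⇒∣m*n (+ suc (period ψ)) Div.∣-refl)) χ (moduliDivide-period χ)
  where
  product : ∀ {a} → a ∣ₛ + suc (period ψ) * + suc (period χ) → a ∣ₛ + suc (period ψ ⊛ period χ)
  product {a} = subst (a ∣ₛ_) (sym (ℤP.pos-* (suc (period ψ)) (suc (period χ))))

moduliDivide-period (dvdʸ d t)  = Div.∣-refl
moduliDivide-period (ndvdʸ d t) = Div.∣-refl
moduliDivide-period (ψ ∧u χ)    = productDivides ψ χ
moduliDivide-period (ψ ∨u χ)    = productDivides ψ χ
moduliDivide-period (free φ)    = tt
moduliDivide-period (lower t)   = tt
moduliDivide-period (upper t)   = tt

∣-shift : ∀ {a w} u → a ∣ₛ w → (a ∣ₛ u) ⇔ (a ∣ₛ u + w)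
∣-shift u a∣w = mk⇔ (λ a∣u → Div.∣m∣n⇒∣m+n a∣u a∣w) (λ a∣u+w → Div.∣m+n∣n⇒∣m a∣u+w a∣w)

shift-atom : ∀ y w t → (y + w) + t ≡ (y + t) + w
shift-atom = solve-∀

minusInfinity-periodic : (ψ : UF n) {D : ℤ} → ModuliDivide D ψ → ∀ y z ρ →
                         ⟦ minusInfinity ψ ⟧ᵘ y ρ ⇔ ⟦ minusInfinity ψ ⟧ᵘ (y + D * z) ρ
minusInfinity-periodic (dvdʸ d t) d∣D y z ρ =
  ⇔-trans (∣-shift (y + ⟦ t ⟧ˡ ρ) (Div.∣m⇒∣m*n z d∣D)) (≡⇒⇔ (cong (_ ∣ₛ_) (sym (shift-atom y _ _))))
minusInfinity-periodic (ndvdʸ d t) d∣D y z ρ =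
  ¬-⇔ (⇔-trans (∣-shift (y + ⟦ t ⟧ˡ ρ) (Div.∣m⇒∣m*n z d∣D)) (≡⇒⇔ (cong (_ ∣ₛ_) (sym (shift-atom y _ _)))))
minusInfinity-periodic (ψ ∧u χ) (mψ , mχ) y z ρ =
  minusInfinity-periodic ψ mψ y z ρ ×-⇔ minusInfinity-periodic χ mχ y z ρ
minusInfinity-periodic (ψ ∨u χ) (mψ , mχ) y z ρ =
  minusInfinity-periodic ψ mψ y z ρ ⊎-⇔ minusInfinity-periodic χ mχ y z ρ
minusInfinity-periodic (free φ) _ y z ρ  = ⇔-refl
minusInfinity-periodic (lower t) _ y z ρ = ⇔-refl
minusInfinity-periodic (upper t) _ y z ρ = ⇔-refl

-- The boundary points of ψ: the least solutions -t of its lower bounds 0 ≤ y + t.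
boundaryPoints : UF n → List (Lin n)
boundaryPoints (lower t) = -1ℤ ·ˡ t ∷ []
boundaryPoints (ψ ∧u χ)  = boundaryPoints ψ ++ boundaryPoints χ
boundaryPoints (ψ ∨u χ)  = boundaryPoints ψ ++ boundaryPoints χ
boundaryPoints _         = []

Clear : ℕ → List (Lin n) → ℤ → Env n → Set
Clear D bs y ρ = ∀ b → b ∈ bs → ∀ j → j ℕ.< D → y ≢ ⟦ b ⟧ˡ ρ + + j

clearˡ : ∀ {D bs cs y} {ρ : Env n} → Clear D (bs ++ cs) y ρ → Clear D bs y ρ
clearˡ clear b b∈bs = clear b (∈-++⁺ˡ b∈bs)

clearʳ : ∀ {D} bs {cs y} {ρ : Env n} → Clear D (bs ++ cs) y ρ → Clear D cs y ρ
clearʳ bs clear b b∈cs = clear b (∈-++⁺ʳ bs b∈cs)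

nonnegative : ∀ {w} → 0ℤ ≤ w → Σ ℕ λ j → w ≡ + j
nonnegative {+ j} _ = j , refl

descent : (ψ : UF n) (D : ℕ) → ModuliDivide (+ D) ψ → ∀ y ρ →
          Clear D (boundaryPoints ψ) y ρ → ⟦ ψ ⟧ᵘ y ρ → ⟦ ψ ⟧ᵘ (y - + D) ρ
descent (lower t) D _ y ρ clear 0≤y+t with + D ℤP.≤? y + ⟦ t ⟧ˡ ρ
... | yes D≤y+t = subst (0ℤ ≤_) (sym (shift-atom y (- + D) (⟦ t ⟧ˡ ρ))) (ℤP.i≤j⇒0≤j-i D≤y+t)
... | no D≰y+t with j , y+t≡j ← nonnegative 0≤y+t =
  ⊥-elim (clear (-1ℤ ·ˡ t) (here refl) j (ℤP.drop‿+<+ (subst (ℤ._< + D) y+t≡j (ℤP.≰⇒> D≰y+t))) y≡b+j)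
  where
  solve-for-y : ∀ y e j → y + e ≡ j → y ≡ - e + j
  solve-for-y y e j eq = trans (sym (law y e)) (cong (_+_ (- e)) eq)
    where
    law : ∀ y e → - e + (y + e) ≡ y
    law = solve-∀
  y≡b+j : y ≡ ⟦ -1ℤ ·ˡ t ⟧ˡ ρ + + j
  y≡b+j = trans (solve-for-y y _ _ y+t≡j) (cong (_+ + j) (sym (trans (⟦·ˡ⟧ -1ℤ t ρ) (ℤP.-1*i≡-i _))))
descent (upper t) D _ y ρ clear 0≤-y+t =
  subst (0ℤ ≤_) (law y (⟦ t ⟧ˡ ρ) (+ D)) (ℤP.+-mono-≤ 0≤-y+t (+≤+ z≤n))
  where
  law : ∀ y e D → (- y + e) + D ≡ - (y - D) + e
  law = solve-∀
descent (dvdʸ d t) D d∣D y ρ clear d∣y+t =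
  subst (_ ∣ₛ_) (sym (shift-atom y (- + D) _)) (Div.∣m∣n⇒∣m-n d∣y+t d∣D)
descent (ndvdʸ d t) D d∣D y ρ clear d∤y+t d∣y-D+t =
  d∤y+t (subst (_ ∣ₛ_) (law y _ (+ D)) (Div.∣m∣n⇒∣m+n (subst (_ ∣ₛ_) (shift-atom y (- + D) _) d∣y-D+t) d∣D))
  where
  law : ∀ y e D → ((y + e) - D) + D ≡ y + e
  law = solve-∀
descent (ψ ∧u χ) D (mψ , mχ) y ρ clear (p , q) =
  descent ψ D mψ y ρ (clearˡ clear) p , descent χ D mχ y ρ (clearʳ (boundaryPoints ψ) clear) q
descent (ψ ∨u χ) D (mψ , mχ) y ρ clear (inj₁ p) = inj₁ (descent ψ D mψ y ρ (clearˡ clear) p)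
descent (ψ ∨u χ) D (mψ , mχ) y ρ clear (inj₂ q) = inj₂ (descent χ D mχ y ρ (clearʳ (boundaryPoints ψ) clear) q)
descent (free φ) D _ y ρ clear p = p

stepsBelow : ∀ y M δ' → Σ ℕ λ k → y - + suc δ' * + k ≤ M
stepsBelow y M δ' = k , subst (y - + suc δ' * + k ≤_) (law y M) (ℤP.+-monoʳ-≤ y (ℤP.neg-mono-≤ y-M≤δk))
  where
  k : ℕ
  k = ℤ.∣ y - M ∣
  i≤∣i∣ : ∀ i → i ≤ + ℤ.∣ i ∣
  i≤∣i∣ (+ _)    = ℤP.≤-refl
  i≤∣i∣ -[1+ _ ] = -≤+
  y-M≤δk : y - M ≤ + suc δ' * + k
  y-M≤δk = ℤP.≤-trans (i≤∣i∣ (y - M)) (subst (+ k ≤_) (ℤP.pos-* (suc δ') k) (+≤+ (ℕP.m≤n*m k (suc δ'))))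
  law : ∀ y M → y + - (y - M) ≡ M
  law = solve-∀

module Cooper (ψ : UF n) where
  δ : ℕ
  δ = suc (period ψ)

  infiniteCase boundaryCase cooper : QF n
  infiniteCase = ⋁ (upTo δ) λ j → minusInfinity ψ [ constˡ n (+ j) ]ᵘ
  boundaryCase = ⋁ (boundaryPoints ψ) λ b → ⋁ (upTo δ) λ j → ψ [ b +ˡ constˡ n (+ j) ]ᵘ
  cooper = infiniteCase ∨q boundaryCase

  module _ (ρ : Env n) where
    infiniteCase⇔ : ⟦ infiniteCase ⟧q ρ ⇔ (Σ ℕ λ j → j ℕ.< δ × ⟦ minusInfinity ψ ⟧ᵘ (+ j) ρ)
    infiniteCase⇔ = ⋁-upTo ρ δ _ (λ j → substitute-const (minusInfinity ψ) j ρ)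

    boundaryCase⇔ : ⟦ boundaryCase ⟧q ρ ⇔
                    (Σ (Lin n) λ b → b ∈ boundaryPoints ψ × Σ ℕ λ j → j ℕ.< δ × ⟦ ψ ⟧ᵘ (⟦ b ⟧ˡ ρ + + j) ρ)
    boundaryCase⇔ = ⋁-correct ρ (boundaryPoints ψ) _ (λ b → ⋁-upTo ρ δ _ (λ j → substitute-shifted ψ b j ρ))

    -- Soundness of the first disjunct: by periodicity ψ₋∞ also holds far
    -- below j, where it agrees with ψ.
    infiniteCase-sound : (Σ ℕ λ j → j ℕ.< δ × ⟦ minusInfinity ψ ⟧ᵘ (+ j) ρ) → Σ ℤ λ y → ⟦ ψ ⟧ᵘ y ρ
    infiniteCase-sound (j , _ , p)
      with M , agree ← minusInfinity-agrees ψ ρ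
      with k , below ← stepsBelow (+ j) M (period ψ) =
      _ , to (agree _ below) (subst (λ v → ⟦ minusInfinity ψ ⟧ᵘ v ρ) (law (+ j) (+ δ) (+ k))
            (to (minusInfinity-periodic ψ (moduliDivide-period ψ) (+ j) (- + k) ρ) p))
      where
      law : ∀ j δ k → j + δ * - k ≡ j - δ * k
      law = solve-∀

    cooper-sound : ⟦ cooper ⟧q ρ → Σ ℤ λ y → ⟦ ψ ⟧ᵘ y ρ
    cooper-sound (inj₁ p) = infiniteCase-sound (to infiniteCase⇔ p)
    cooper-sound (inj₂ q) with b , _ , j , _ , h ← to boundaryCase⇔ q = ⟦ b ⟧ˡ ρ + + j , h

    iterate-descent : ¬ ⟦ boundaryCase ⟧q ρ → ∀ {y} → ⟦ ψ ⟧ᵘ y ρ → ∀ k → ⟦ ψ ⟧ᵘ (y - + δ * + k) ρ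
    iterate-descent none {y} h zero = subst (λ v → ⟦ ψ ⟧ᵘ v ρ) (law y (+ δ)) h
      where
      law : ∀ y δ → y ≡ y - δ * 0ℤ
      law = solve-∀
    iterate-descent none {y} h (suc k) = subst (λ v → ⟦ ψ ⟧ᵘ v ρ) (law y (+ δ) (+ k))
      (descent ψ δ (moduliDivide-period ψ) _ ρ (clear (iterate-descent none h k)) (iterate-descent none h k))
      where
      law : ∀ y δ k → (y - δ * k) - δ ≡ y - δ * (1ℤ + k)
      law = solve-∀
      clear : ∀ {w} → ⟦ ψ ⟧ᵘ w ρ → Clear δ (boundaryPoints ψ) w ρ
      clear hw b b∈ j j<δ w≡b+j = none (from boundaryCase⇔ (b , b∈ , j , j<δ , subst (λ v → ⟦ ψ ⟧ᵘ v ρ) w≡b+j hw))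

    reduce-modulo : ∀ w → ⟦ minusInfinity ψ ⟧ᵘ w ρ → ⟦ minusInfinity ψ ⟧ᵘ (+ (w DM.%ℕ δ)) ρ
    reduce-modulo w p = subst (λ v → ⟦ minusInfinity ψ ⟧ᵘ v ρ) (law w (+ (w DM.%ℕ δ)) (w DM./ℕ δ) (+ δ) (DM.a≡a%ℕn+[a/ℕn]*n w δ))
      (to (minusInfinity-periodic ψ (moduliDivide-period ψ) w (- (w DM./ℕ δ)) ρ) p)
      where
      law : ∀ w r q δ → w ≡ r + q * δ → w + δ * - q ≡ r
      law w r q δ refl = identity r q δ
        where
        identity : ∀ r q δ → (r + q * δ) + δ * - q ≡ r
        identity = solve-∀

    cooper-complete : (Σ ℤ λ y → ⟦ ψ ⟧ᵘ y ρ) → ⟦ cooper ⟧q ρ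
    cooper-complete (y , h) with ⟦ boundaryCase ⟧q? ρ
    ... | yes b = inj₂ b
    ... | no none
      with M , agree ← minusInfinity-agrees ψ ρ
      with k , below ← stepsBelow y M (period ψ) =
      inj₁ (from infiniteCase⇔ (_ , DM.n%ℕd<d w δ , reduce-modulo w (from (agree w below) (iterate-descent none h k))))
      where
      w : ℤ
      w = y - + δ * + k

    cooper-correct : ⟦ cooper ⟧q ρ ⇔ (Σ ℤ λ y → ⟦ ψ ⟧ᵘ y ρ)
    cooper-correct = mk⇔ cooper-sound cooper-complete

∃-elim : QF (suc n) → QF n
∃-elim φ = Cooper.cooper (unitForm φ)

∃-elim-correct : (φ : QF (suc n)) (ρ : Env n) → ⟦ ∃-elim φ ⟧q ρ ⇔ (Σ ℤ λ x → ⟦ φ ⟧q (extend x ρ))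
∃-elim-correct φ ρ = ⇔-trans (Cooper.cooper-correct (unitForm φ) ρ) (⇔-sym (unitForm-correct φ ρ))

∀⇔¬∃¬ : {P : ℤ → Set} → (∀ x → Dec (P x)) → (∀ x → P x) ⇔ (¬ Σ ℤ λ x → ¬ P x)
∀⇔¬∃¬ P? = mk⇔ (λ all (x , ¬p) → ¬p (all x)) (λ ¬∃¬ x → decidable-stable (P? x) (λ ¬p → ¬∃¬ (x , ¬p)))

∃-⇔ : {P Q : ℤ → Set} → (∀ x → P x ⇔ Q x) → (Σ ℤ P) ⇔ (Σ ℤ Q)
∃-⇔ P⇔Q = mk⇔ (λ { (x , p) → x , to (P⇔Q x) p }) (λ { (x , q) → x , from (P⇔Q x) q })

∀-⇔ : {P Q : ℤ → Set} → (∀ x → P x ⇔ Q x) → (∀ x → P x) ⇔ (∀ x → Q x)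
∀-⇔ P⇔Q = mk⇔ (λ p x → to (P⇔Q x) (p x)) (λ q x → from (P⇔Q x) (q x))

linearise : Term n → Lin n
linearise (var i)     = varˡ i
linearise {n} (const c) = constˡ n c
linearise (s ⊕ t)     = linearise s +ˡ linearise t
linearise (scale c t) = c ·ˡ linearise t

linearise-correct : (t : Term n) (ρ : Env n) → ⟦ linearise t ⟧ˡ ρ ≡ ⟦ t ⟧ₜ ρ
linearise-correct (var i) ρ     = ⟦varˡ⟧ i ρ
linearise-correct {n} (const c) ρ = ⟦constˡ⟧ n c ρ
linearise-correct (s ⊕ t) ρ     = trans (⟦+ˡ⟧ (linearise s) _ ρ) (cong₂ _+_ (linearise-correct s ρ) (linearise-correct t ρ))
linearise-correct (scale c t) ρ = trans (⟦·ˡ⟧ c (linearise t) ρ) (cong (c *_) (linearise-correct t ρ))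

_≼_ : Term n → Term n → QF n
s ≼ t = nonneg (linearise t +ˡ -1ℤ ·ˡ linearise s)

≼-correct : (s t : Term n) (ρ : Env n) → ⟦ s ≼ t ⟧q ρ ⇔ (⟦ s ⟧ₜ ρ ≤ ⟦ t ⟧ₜ ρ)
≼-correct s t ρ = ⇔-trans (≡⇒⇔ (cong (0ℤ ≤_) difference)) (mk⇔ ℤP.0≤i-j⇒j≤i ℤP.i≤j⇒0≤j-i)
  where
  law : ∀ t s → t + -1ℤ * s ≡ t - s
  law = solve-∀
  difference : ⟦ linearise t +ˡ -1ℤ ·ˡ linearise s ⟧ˡ ρ ≡ ⟦ t ⟧ₜ ρ - ⟦ s ⟧ₜ ρ
  difference = trans (⟦+ˡ⟧ (linearise t) _ ρ)
    (trans (cong₂ _+_ (linearise-correct t ρ) (trans (⟦·ˡ⟧ -1ℤ (linearise s) ρ) (cong (-1ℤ *_) (linearise-correct s ρ))))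
           (law (⟦ t ⟧ₜ ρ) (⟦ s ⟧ₜ ρ)))

eliminate : Formula n → QF n
eliminate (s ≤ᶠ t) = s ≼ t
eliminate (s ≐ t)  = (s ≼ t) ∧q (t ≼ s)
eliminate (¬ᶠ φ)   = negQ (eliminate φ)
eliminate (φ ∧ᶠ ψ) = eliminate φ ∧q eliminate ψ
eliminate (φ ∨ᶠ ψ) = eliminate φ ∨q eliminate ψ
eliminate (∃ᶠ φ)   = ∃-elim (eliminate φ)
eliminate (∀ᶠ φ)   = negQ (∃-elim (negQ (eliminate φ)))

eliminate-correct : (φ : Formula n) (ρ : Env n) → ⟦ eliminate φ ⟧q ρ ⇔ ⟦ φ ⟧ ρ
eliminate-correct (s ≤ᶠ t) ρ = ≼-correct s t ρ
eliminate-correct (s ≐ t) ρ  = ⇔-trans (≼-correct s t ρ ×-⇔ ≼-correct t s ρ)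
  (mk⇔ (λ { (s≤t , t≤s) → ℤP.≤-antisym s≤t t≤s }) (λ s≡t → ℤP.≤-reflexive s≡t , ℤP.≤-reflexive (sym s≡t)))
eliminate-correct (¬ᶠ φ) ρ   = ⇔-trans (negQ-correct (eliminate φ) ρ) (¬-⇔ (eliminate-correct φ ρ))
eliminate-correct (φ ∧ᶠ ψ) ρ = eliminate-correct φ ρ ×-⇔ eliminate-correct ψ ρ
eliminate-correct (φ ∨ᶠ ψ) ρ = eliminate-correct φ ρ ⊎-⇔ eliminate-correct ψ ρ
eliminate-correct (∃ᶠ φ) ρ   = ⇔-trans (∃-elim-correct (eliminate φ) ρ) (∃-⇔ λ x → eliminate-correct φ (extend x ρ))
eliminate-correct (∀ᶠ φ) ρ   = begin
  ⟦ negQ (∃-elim (negQ (eliminate φ))) ⟧q ρ           ≈⟨ negQ-correct (∃-elim (negQ (eliminate φ))) ρ ⟩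
  (¬ ⟦ ∃-elim (negQ (eliminate φ)) ⟧q ρ)              ≈⟨ ¬-⇔ (∃-elim-correct (negQ (eliminate φ)) ρ) ⟩
  (¬ Σ ℤ λ x → ⟦ negQ (eliminate φ) ⟧q (extend x ρ))  ≈⟨ ¬-⇔ (∃-⇔ λ x → negQ-correct (eliminate φ) (extend x ρ)) ⟩
  (¬ Σ ℤ λ x → ¬ ⟦ eliminate φ ⟧q (extend x ρ))       ≈⟨ ∀⇔¬∃¬ (λ x → ⟦ eliminate φ ⟧q? (extend x ρ)) ⟨
  (∀ x → ⟦ eliminate φ ⟧q (extend x ρ))               ≈⟨ ∀-⇔ (λ x → eliminate-correct φ (extend x ρ)) ⟩
  (∀ x → ⟦ φ ⟧ (extend x ρ))                          ∎
  where open ⇔-Reasoning (⇔-setoid 0ℓ)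

presburger? : (φ : Formula n) (ρ : Env n) → Dec (⟦ φ ⟧ ρ)
presburger? φ ρ = Dec.map (eliminate-correct φ ρ) (⟦ eliminate φ ⟧q? ρ)

_≗ₑ_ : Env n → Env n → Set
ρ ≗ₑ σ = ∀ i → ρ i ≡ σ i

extend-cong : ∀ x {ρ σ : Env n} → ρ ≗ₑ σ → extend x ρ ≗ₑ extend x σ
extend-cong x ρ≗σ zero    = refl
extend-cong x ρ≗σ (suc i) = ρ≗σ i

⟦⟧ₜ-cong : (t : Term n) {ρ σ : Env n} → ρ ≗ₑ σ → ⟦ t ⟧ₜ ρ ≡ ⟦ t ⟧ₜ σ
⟦⟧ₜ-cong (var i) ρ≗σ     = ρ≗σ i
⟦⟧ₜ-cong (const c) ρ≗σ   = refl
⟦⟧ₜ-cong (s ⊕ t) ρ≗σ     = cong₂ _+_ (⟦⟧ₜ-cong s ρ≗σ) (⟦⟧ₜ-cong t ρ≗σ)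
⟦⟧ₜ-cong (scale c t) ρ≗σ = cong (c *_) (⟦⟧ₜ-cong t ρ≗σ)

⟦⟧-cong : (φ : Formula n) {ρ σ : Env n} → ρ ≗ₑ σ → ⟦ φ ⟧ ρ ⇔ ⟦ φ ⟧ σ
⟦⟧-cong (s ≤ᶠ t) ρ≗σ = ≡⇒⇔ (cong₂ _≤_ (⟦⟧ₜ-cong s ρ≗σ) (⟦⟧ₜ-cong t ρ≗σ))
⟦⟧-cong (s ≐ t) ρ≗σ  = ≡⇒⇔ (cong₂ _≡_ (⟦⟧ₜ-cong s ρ≗σ) (⟦⟧ₜ-cong t ρ≗σ))
⟦⟧-cong (¬ᶠ φ) ρ≗σ   = ¬-⇔ (⟦⟧-cong φ ρ≗σ)
⟦⟧-cong (φ ∧ᶠ ψ) ρ≗σ = ⟦⟧-cong φ ρ≗σ ×-⇔ ⟦⟧-cong ψ ρ≗σ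
⟦⟧-cong (φ ∨ᶠ ψ) ρ≗σ = ⟦⟧-cong φ ρ≗σ ⊎-⇔ ⟦⟧-cong ψ ρ≗σ
⟦⟧-cong (∃ᶠ φ) ρ≗σ   = ∃-⇔ λ x → ⟦⟧-cong φ (extend-cong x ρ≗σ)
⟦⟧-cong (∀ᶠ φ) ρ≗σ   = ∀-⇔ λ x → ⟦⟧-cong φ (extend-cong x ρ≗σ)

satisfiable? : (φ : Formula 3) → Dec (Σ ℤ λ x → Σ ℤ λ y → Σ ℤ λ z → ⟦ φ ⟧ (env3 x y z))
satisfiable? φ = Dec.map′ forth back (presburger? (∃ᶠ (∃ᶠ (∃ᶠ φ))) noVariables)
  where
  noVariables : Env 0
  noVariables ()
  nested : ∀ x y z → env3 x y z ≗ₑ extend x (extend y (extend z noVariables))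
  nested x y z zero             = refl
  nested x y z (suc zero)       = refl
  nested x y z (suc (suc zero)) = refl
  forth : ⟦ ∃ᶠ (∃ᶠ (∃ᶠ φ)) ⟧ noVariables → Σ ℤ λ x → Σ ℤ λ y → Σ ℤ λ z → ⟦ φ ⟧ (env3 x y z)
  forth (z , y , x , h) = x , y , z , from (⟦⟧-cong φ (nested x y z)) h
  back : (Σ ℤ λ x → Σ ℤ λ y → Σ ℤ λ z → ⟦ φ ⟧ (env3 x y z)) → ⟦ ∃ᶠ (∃ᶠ (∃ᶠ φ)) ⟧ noVariables
  back (x , y , z , h) = z , y , x , to (⟦⟧-cong φ (nested x y z)) h

unique-length : ∀ {k} (xs : List (Fin k)) → Unique xs → length xs ℕ.≤ k
unique-length {k} xs unique with length xs ℕP.≤? k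
... | yes short = short
... | no long with i , j , i<j , same ← FinP.pigeonhole (ℕP.≰⇒> long) (lookup xs) = ⊥-elim (distinct unique i j i<j same)
  where
  distinct : ∀ {ys : List (Fin k)} → Unique ys → ∀ i j → i Fin.< j → lookup ys i ≢ lookup ys j
  distinct (fresh ∷ _) zero (suc j) _            = All.lookup fresh (∈-lookup j)
  distinct (_ ∷ unique) (suc i) (suc j) (s≤s i<j) = distinct unique i j i<j

-- Reachability in a finite graph with decidable edges is decidable: it
-- suffices to search the walks of length at most k, since any walk can be
-- shortened to one without repeated vertices.
module FiniteGraph {k : ℕ} (Edge : Fin k → Fin k → Set) (edge? : ∀ p q → Dec (Edge p q)) where

  data Walk : Fin k → Fin k → Set where
    []ʷ   : ∀ {q} → Walk q q
    _∷ʷ_  : ∀ {p r q} → Edge p r → Walk r q → Walk p q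

  vertices : ∀ {p q} → Walk p q → List (Fin k)
  vertices {q = q} []ʷ      = q ∷ []
  vertices {p = p} (e ∷ʷ w) = p ∷ vertices w

  steps : ∀ {p q} → Walk p q → ℕ
  steps []ʷ      = 0
  steps (e ∷ʷ w) = suc (steps w)

  length-vertices : ∀ {p q} (w : Walk p q) → length (vertices w) ≡ suc (steps w)
  length-vertices []ʷ      = refl
  length-vertices (e ∷ʷ w) = cong suc (length-vertices w)

  SimpleWalk : Fin k → Fin k → Set
  SimpleWalk p q = Σ (Walk p q) λ w → Unique (vertices w)

  suffix : ∀ {p s q} (w : Walk s q) → Unique (vertices w) → p ∈ vertices w → SimpleWalk p q
  suffix []ʷ      u (here refl)     = []ʷ , u
  suffix (e ∷ʷ w) u (here refl)     = (e ∷ʷ w) , u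
  suffix (e ∷ʷ w) (_ ∷ u) (there m) = suffix w u m

  simplify : ∀ {p q} → Walk p q → SimpleWalk p q
  simplify []ʷ      = []ʷ , (All.[] ∷ [])
  simplify {p} (e ∷ʷ w) with w′ , u ← simplify w with DecMembership._∈?_ FinP._≟_ p (vertices w′)
  ... | yes p∈w′ = suffix w′ u p∈w′
  ... | no  p∉w′ = (e ∷ʷ w′) , (¬Any⇒All¬ (vertices w′) p∉w′ ∷ u)

  WithinSteps : ℕ → Fin k → Fin k → Set
  WithinSteps zero p q    = p ≡ q
  WithinSteps (suc m) p q = p ≡ q ⊎ Σ (Fin k) λ r → Edge p r × WithinSteps m r q

  withinSteps? : ∀ m p q → Dec (WithinSteps m p q)
  withinSteps? zero p q    = p FinP.≟ q
  withinSteps? (suc m) p q = (p FinP.≟ q) ⊎-dec FinP.any? (λ r → edge? p r ×-dec withinSteps? m r q)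

  withinSteps⇒walk : ∀ m {p q} → WithinSteps m p q → Walk p q
  withinSteps⇒walk zero refl                    = []ʷ
  withinSteps⇒walk (suc m) (inj₁ refl)          = []ʷ
  withinSteps⇒walk (suc m) (inj₂ (r , e , rest)) = e ∷ʷ withinSteps⇒walk m rest

  walk⇒withinSteps : ∀ {p q} (w : Walk p q) m → steps w ℕ.≤ m → WithinSteps m p q
  walk⇒withinSteps []ʷ zero _                = refl
  walk⇒withinSteps []ʷ (suc m) _             = inj₁ refl
  walk⇒withinSteps (e ∷ʷ w) (suc m) (s≤s le) = inj₂ (_ , e , walk⇒withinSteps w m le)

  simple-steps : ∀ {p q} ((w , u) : SimpleWalk p q) → steps w ℕ.≤ k
  simple-steps (w , u) = ℕP.<⇒≤ (subst (ℕ._≤ k) (length-vertices w) (unique-length (vertices w) u))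

  reachable? : ∀ p q → Dec (Walk p q)
  reachable? p q with withinSteps? k p q
  ... | yes within = yes (withinSteps⇒walk k within)
  ... | no ¬within = no λ w → ¬within (walk⇒withinSteps (proj₁ (simplify w)) k (simple-steps (simplify w)))

≡[]-refl : ∀ k u → u ≡[ k ] u
≡[]-refl k u = subst (λ v → k ℕDiv.∣ ℤ.∣ v ∣) (sym (ℤP.+-inverseʳ u)) (k ℕDiv.∣0)

module Automaton (N : SNFA) where
  open SNFA N

  OrbitEdge : Fin nQ → Fin nQ → Set
  OrbitEdge p q = Σ (Fin nA) λ a → Σ ℤ λ x → Σ ℤ λ y → Σ ℤ λ z → ⟦ δ p a q ⟧ (env3 x y z)

  orbitEdge? : ∀ p q → Dec (OrbitEdge p q)
  orbitEdge? p q = FinP.any? λ a → satisfiable? (δ p a q)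

  open FiniteGraph OrbitEdge orbitEdge?

  run⇒walk : ∀ {s w s′} → Run N s w s′ → Walk (proj₁ s) (proj₁ s′)
  run⇒walk done = []ʷ
  run⇒walk (step {a = a , _} (x′ , y′ , z′ , _ , _ , _ , h) run) = (a , x′ , y′ , z′ , h) ∷ʷ run⇒walk run

  -- Conversely, by equivariance every edge can be translated to start at any
  -- point of its orbit, so every walk lifts to a run from any state of its
  -- first orbit.
  walk⇒run : Equivariant N → ∀ {p q} → Walk p q → ∀ x → Σ (List (Letter N)) λ w → Σ ℤ λ z → Run N (p , x) w (q , z)
  walk⇒run eqv []ʷ x = [] , x , done
  walk⇒run eqv {p} (_∷ʷ_ {r = r} (a , x′ , y′ , z′ , h) walk) x
    with w , z , run ← walk⇒run eqv walk (z′ + (x - x′)) =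
    (a , y′ + (x - x′)) ∷ w , z , step translated run
    where
    cancel : ∀ x x′ → x′ + (x - x′) ≡ x
    cancel = solve-∀
    translated : Trans N (p , x) (a , y′ + (x - x′)) (r , z′ + (x - x′))
    translated = subst (λ v → Trans N (p , v) (a , y′ + (x - x′)) (r , z′ + (x - x′))) (cancel x x′)
      (eqv (x - x′) (p , x′) (a , y′) (r , z′)
        (x′ , y′ , z′ , ≡[]-refl (stat p) x′ , ≡[]-refl (alph a) y′ , ≡[]-refl (stat r) z′ , h))

  OrbitPath : Set
  OrbitPath = Σ (Fin nQ) λ p → Σ (Fin nQ) λ q → init p ≡ true × final q ≡ true × Walk p q

  orbitPath? : Dec OrbitPath
  orbitPath? = FinP.any? λ p → FinP.any? λ q → (init p BoolP.≟ true) ×-dec (final q BoolP.≟ true) ×-dec reachable? p q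

  noOrbitPath⇔empty : Equivariant N → (¬ OrbitPath) ⇔ LanguageEmpty N
  noOrbitPath⇔empty eqv = mk⇔
    (λ noPath w ((p , _) , (q , _) , p-init , run , q-final) → noPath (p , q , p-init , q-final , run⇒walk run))
    (λ empty (p , q , p-init , q-final , walk) →
       let (w , z , run) = walk⇒run eqv walk 0ℤ in empty w ((p , 0ℤ) , (q , z) , p-init , run , q-final))

theorem2 : (N : SNFA) → Equivariant N → Dec (LanguageEmpty N)
theorem2 N eqv = Dec.map (noOrbitPath⇔empty eqv) (¬? orbitPath?)
  where open Automaton N
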